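{- Let $E$ be a homogeneous broadcast environment and $\mathbf{P}$ a joint perfect recall protocol. If $r_1,r_2$ are traces in $F_{E,\mathbf{P}}$ with $\mathbf{A}(r_1)=\mathbf{A}(r_2)$, then for every $i\in\{0,\dots,n\}$, $r_1\bowtie_ir_2$ is a trace in $F_{E,\mathbf{P}}$ with $(r_1\bowtie_ir_2)\sim_ir_2$ and $(r_1\bowtie_ir_2)\sim_jr_1$ for all $j\neq i$, $j\in\{0,\dots,n\}$.
   Context: Broadcast environments (agents $0,\dots,n$): for each $i$ sets $A_i\ni\epsilon$, $B_i$, $S_i$; actions of $i$ are pairs $a\cdot b$; joint actions $\mathbf{j}=\langle a_0\cdot b_0,\dots,a_n\cdot b_n\rangle$ with $\mathbf{a}(\mathbf{j})=\langle a_0,\dots,a_n\rangle$. States $s=\langle a_0,\dots,a_n;p_0,\dots,p_n\rangle$ ($a_i\in A_i,p_i\in S_i$), $\mathbf{a}(s)=\langle a_0,\dots,a_n\rangle$. Transition: $\tau(\mathbf{j})(\langle a'_0,\dots;p_0,\dots,p_n\rangle)=\langle a_0,\dots,a_n;\tau_0(\mathbf{a}(\mathbf{j}),b_0)(p_0),\dots,\tau_n(\mathbf{a}(\mathbf{j}),b_n)(p_n)\rangle$ for given $\tau_i:(A_0\times\dots\times A_n)\times B_i\to(S_i\to S_i)$. Observations $O_i(\langle a_0,\dots,a_n;p_0,\dots,p_n\rangle)=\langle a_0,\dots,a_n;p_i\rangle$, $i=0,\dots,n$. Environment protocol $P_0$ from states to sets of agent-0 actions with $P_0(s)=P_0(t)$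 whenever $O_0(s)=O_0(t)$. Homogeneous: initial states are exactly $\{\langle\epsilon,\dots,\epsilon;p_0,\dots,p_n\rangle:p_i\in I_i\}$ for given nonempty $I_i\subseteq S_i$. Trace: $s_0\dots s_m$, $s_0$ initial, each $s_{k+1}=\tau(\mathbf{j})(s_k)$ for some $\mathbf{j}$ with agent-0 component in $P_0(s_k)$; $\mathrm{fin}(r)$ = last state; $\{r\}_i=O_i(s_0)\dots O_i(s_m)$; $\mathbf{A}(r)=\mathbf{a}(s_0)\dots\mathbf{a}(s_m)$. Joint perfect recall protocol $\mathbf{P}=\langle P_1,\dots,P_n\rangle$, $P_i$ mapping observation sequences to nonempty sets of agent-$i$ actions; a joint action is enabled at $r$ if its 0-component is in $P_0(\mathrm{fin}(r))$ and its $i$-component in $P_i(\{r\}_i)$; a trace is consistent with $\mathbf{P}$ if each step is produced by a joint action enabled at the preceding prefix; the traces "in $F_{E,\mathbf{P}}$" are those consistent with $\mathbf{P}$. For $i=0,\dots,n$, $r\sim_ir'$ iff $\{r\}_i=\{r'\}_i$. For states $s=\langle a_0,\dots,a_n;p_0,\dots,p_n\rangle$, $t=\langle a_0,\dots,a_n;q_0,\dots,q_n\rangle$ with the same external part, $s\bowtie_it=\langle a_0,\dots,a_n;p_0,\dots,p_{i-1},q_i,p_{i+1},\dots,p_n\rangle$; for state sequences $r_1=s_0\dots s_m$, $r_2=t_0\dots t_m$ with $\mathbf{A}(r_1)=\mathbf{A}(r_2)$, $r_1\bowtie_ir_2=(s_0\bowtie_it_0)\dots(s_m\bowtie_it_m)$.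 -}

module Defs where

open import Data.Nat using (ℕ; zero; suc)
open import Data.Fin using (Fin; zero; suc)
open import Data.Unit using (⊤; tt)
open import Data.Product using (Σ; ∃; _×_; _,_; proj₁; proj₂)
open import Data.List.NonEmpty using (List⁺; [_]; _⁺∷ʳ_; map)
open import Relation.Binary.PropositionalEquality using (_≡_)

Tup : (n : ℕ) → (Fin n → Set) → Set
Tup zero    F = ⊤
Tup (suc n) F = F zero × Tup n (λ i → F (suc i))

lookupT : ∀ {n} {F : Fin n → Set} → Tup n F → (i : Fin n) → F i
lookupT {suc n} (x , xs) zero    = x
lookupT {suc n} (x , xs) (suc i) = lookupT xs i

mapT : ∀ {n} {F G : Fin n → Set} → ((i : Fin n) → F i → G i) → Tup n F → Tup n G
mapT {zero}  f tt       = tt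
mapT {suc n} f (x , xs) = f zero x , mapT (λ i → f (suc i)) xs

tabulateT : ∀ {n} {F : Fin n → Set} → ((i : Fin n) → F i) → Tup n F
tabulateT {zero}  f = tt
tabulateT {suc n} f = f zero , tabulateT (λ i → f (suc i))

updateT : ∀ {n} {F : Fin n → Set} → (i : Fin n) → F i → Tup n F → Tup n F
updateT {suc n} zero    y (x , xs) = y , xs
updateT {suc n} (suc i) y (x , xs) = x , updateT i y xs

record BroadcastSig (n : ℕ) : Set₁ where
  field
    A : Fin (suc n) → Set                 -- external (broadcast) action parts
    ε : (i : Fin (suc n)) → A i
    B : Fin (suc n) → Set                 -- internal action parts
    S : Fin (suc n) → Set
    τ : (i : Fin (suc n)) → Tup (suc n) A → B i → S i → S i
    I : (i : Fin (suc n)) → S i → Set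
    I-nonempty : (i : Fin (suc n)) → ∃ (I i)

  State : Set
  State = Tup (suc n) A × Tup (suc n) S

  Act : Fin (suc n) → Set
  Act i = A i × B i

  JointAct : Set
  JointAct = Tup (suc n) Act

  aJ : JointAct → Tup (suc n) A
  aJ j = mapT {F = Act} {G = A} (λ i → proj₁) j

  aS : State → Tup (suc n) A
  aS = proj₁

  τJ : JointAct → State → State
  τJ j s = aJ j , mapT {F = S} {G = S} (λ i p → τ i (aJ j) (proj₂ (lookupT {F = Act} j i)) p) (proj₂ s)

  Obs : Fin (suc n) → Set
  Obs i = Tup (suc n) A × S i

  O : (i : Fin (suc n)) → State → Obs i
  O i s = proj₁ s , lookupT {F = S} (proj₂ s) i

  Initial : State → Set
  Initial s = (proj₁ s ≡ tabulateT {F = A} ε) × ((i : Fin (suc n)) → I i (lookupT {F = S} (proj₂ s) i))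

  bowS : Fin (suc n) → State → State → State
  bowS i s t = proj₁ s , updateT {F = S} i (lookupT {F = S} (proj₂ t) i) (proj₂ s)

-- a homogeneous broadcast environment together with its protocol P_0
record HomBroadcastEnv (n : ℕ) : Set₁ where
  field
    sig : BroadcastSig n
  open BroadcastSig sig public
  field
    P0 : State → Act zero → Set
    P0-local : ∀ s t → O zero s ≡ O zero t → ∀ x → P0 s x → P0 t x

module _ {n : ℕ} (E : HomBroadcastEnv n) where
  open HomBroadcastEnv E

  data Run : Set where
    ⟦_⟧ : State → Run
    _▷_ : Run → State → Run

  fin : Run → State
  fin ⟦ s ⟧   = s
  fin (r ▷ s) = s

  states : Run → List⁺ State
  states ⟦ s ⟧   = [ s ]
  states (r ▷ s) = states r ⁺∷ʳ s

  obsSeq : (i : Fin (suc n)) → Run → List⁺ (Obs i)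
  obsSeq i r = map (O i) (states r)

  ASeq : Run → List⁺ (Tup (suc n) A)
  ASeq r = map aS (states r)

  _∼[_]_ : Run → Fin (suc n) → Run → Set
  r ∼[ i ] r' = obsSeq i r ≡ obsSeq i r'

  -- r_1 ⋈_i r_2 (meaningful when the runs have equal length; otherwise returns r_1)
  bowR : Fin (suc n) → Run → Run → Run
  bowR i ⟦ s ⟧     ⟦ t ⟧     = ⟦ bowS i s t ⟧
  bowR i (r ▷ s)   (r' ▷ t)  = bowR i r r' ▷ bowS i s t
  bowR i ⟦ s ⟧     (r' ▷ t)  = ⟦ s ⟧
  bowR i (r ▷ s)   ⟦ t ⟧     = r ▷ s

  record JointProtocol : Set₁ where
    field
      P : (i : Fin n) → List⁺ (Obs (suc i)) → Act (suc i) → Set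
      P-nonempty : (i : Fin n) (o : List⁺ (Obs (suc i))) → ∃ (P i o)

  module _ (𝐏 : JointProtocol) where
    open JointProtocol 𝐏

    Enabled : Run → JointAct → Set
    Enabled r j = P0 (fin r) (lookupT {F = Act} j zero)
                × ((i : Fin n) → P i (obsSeq (suc i) r) (lookupT {F = Act} j (suc i)))

    data InF : Run → Set where
      init : ∀ s → Initial s → InF ⟦ s ⟧
      step : ∀ r s (j : JointAct) → InF r → Enabled r j → s ≡ τJ j (fin r) → InF (r ▷ s)

{-# OPTIONS --safe #-}
-- Everything agent k does in one step is determined by what k sees: its enabled actions depend
-- only on its observation history (the environment's only on its current observation), and its
-- local transition only on the broadcast actions and its own internal action. Since r₁ and r₂
-- broadcast the same actions, every agent sees in r₁ ⋈ᵢ r₂ exactly what it sees in the run the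
-- splice takes its local state from, so the spliced joint actions are enabled and produce the
-- spliced states; homogeneity makes the spliced initial state initial.
module Submission where

open import Defs
open import Data.Nat using (ℕ; suc)
open import Data.Fin using (Fin; zero; suc)
open import Data.Fin.Properties using (_≟_; suc-injective)
open import Function using (_∘′_)
open import Data.Unit using (tt)
open import Data.Product using (_×_; _,_; proj₁; proj₂)
open import Data.List using ([]; _∷_)
open import Data.List.Properties using (map-++; ∷ʳ-injective)
open import Data.List.NonEmpty as List⁺ using (List⁺; _∷_; [_]; _⁺∷ʳ_)
open import Relation.Nullary using (yes; no; contradiction)
open import Relation.Binary.PropositionalEquality
  using (_≡_; _≢_; refl; sym; trans; cong; cong₂; subst; module ≡-Reasoning)

spliceT : ∀ {n} {F : Fin n → Set} → Fin n → Tup n F → Tup n F → Tup n F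
spliceT {F = F} i xs ys = updateT {F = F} i (lookupT {F = F} ys i) xs

lookupT-updateT-≡ : ∀ {n} {F : Fin n → Set} (i : Fin n) (y : F i) (xs : Tup n F) →
  lookupT {F = F} (updateT {F = F} i y xs) i ≡ y
lookupT-updateT-≡ {suc n}     zero    y (x , xs) = refl
lookupT-updateT-≡ {suc n} {F} (suc i) y (x , xs) = lookupT-updateT-≡ {F = λ k → F (suc k)} i y xs

lookupT-updateT-≢ : ∀ {n} {F : Fin n → Set} {i k : Fin n} (y : F i) (xs : Tup n F) → k ≢ i →
  lookupT {F = F} (updateT {F = F} i y xs) k ≡ lookupT {F = F} xs k
lookupT-updateT-≢ {suc n}     {i = zero}  {zero}  y (x , xs) k≢i = contradiction refl k≢i
lookupT-updateT-≢ {suc n}     {i = zero}  {suc k} y (x , xs) k≢i = refl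
lookupT-updateT-≢ {suc n}     {i = suc i} {zero}  y (x , xs) k≢i = refl
lookupT-updateT-≢ {suc n} {F} {i = suc i} {suc k} y (x , xs) k≢i =
  lookupT-updateT-≢ {F = λ k → F (suc k)} y xs (k≢i ∘′ cong suc)

lookupT-updateT-elim : ∀ {n} {F : Fin n → Set} (Q : (k : Fin n) → F k → Set)
  {i : Fin n} {y : F i} {xs : Tup n F} →
  Q i y → (∀ k → k ≢ i → Q k (lookupT {F = F} xs k)) →
  ∀ k → Q k (lookupT {F = F} (updateT {F = F} i y xs) k)
lookupT-updateT-elim {F = F} Q {i} {y} {xs} Qy Qxs k with k ≟ i
... | yes refl = subst (Q k) (sym (lookupT-updateT-≡ {F = F} k y xs)) Qy
... | no k≢i   = subst (Q k) (sym (lookupT-updateT-≢ {F = F} y xs k≢i)) (Qxs k k≢i)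

updateT-lookupT : ∀ {n} {F : Fin n → Set} (i : Fin n) (xs : Tup n F) →
  updateT {F = F} i (lookupT {F = F} xs i) xs ≡ xs
updateT-lookupT {suc n}     zero    (x , xs) = refl
updateT-lookupT {suc n} {F} (suc i) (x , xs) = cong (x ,_) (updateT-lookupT {F = λ k → F (suc k)} i xs)

mapT-cong : ∀ {n} {F G : Fin n → Set} {f g : (k : Fin n) → F k → G k} →
  (∀ k p → f k p ≡ g k p) → (xs : Tup n F) → mapT {F = F} {G = G} f xs ≡ mapT {F = F} {G = G} g xs
mapT-cong {0}             f≗g tt       = refl
mapT-cong {suc n} {F} {G} f≗g (x , xs) =
  cong₂ _,_ (f≗g zero x) (mapT-cong {F = λ k → F (suc k)} {G = λ k → G (suc k)} (λ k → f≗g (suc k)) xs)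

mapT-spliceT : ∀ {n} {F G : Fin n → Set} (f g h : (k : Fin n) → F k → G k) (i : Fin n) →
  (∀ p → h i p ≡ g i p) → (∀ k → k ≢ i → ∀ p → h k p ≡ f k p) →
  (xs ys : Tup n F) →
  mapT {F = F} {G = G} h (spliceT {F = F} i xs ys)
    ≡ spliceT {F = G} i (mapT {F = F} {G = G} f xs) (mapT {F = F} {G = G} g ys)
mapT-spliceT {suc n} {F} {G} f g h zero h≗g h≗f (x , xs) (y , ys) =
  cong₂ _,_ (h≗g y)
    (mapT-cong {F = λ k → F (suc k)} {G = λ k → G (suc k)} (λ k → h≗f (suc k) λ ()) xs)
mapT-spliceT {suc n} {F} {G} f g h (suc i) h≗g h≗f (x , xs) (y , ys) =
  cong₂ _,_ (h≗f zero (λ ()) x)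
    (mapT-spliceT {F = λ k → F (suc k)} {G = λ k → G (suc k)}
      (λ k → f (suc k)) (λ k → g (suc k)) (λ k → h (suc k)) i h≗g
      (λ k k≢i → h≗f (suc k) (k≢i ∘′ suc-injective)) xs ys)

module _ {A : Set} where

  map-⁺∷ʳ : ∀ {B : Set} (f : A → B) (xs : List⁺ A) (x : A) →
    List⁺.map f (xs ⁺∷ʳ x) ≡ List⁺.map f xs ⁺∷ʳ f x
  map-⁺∷ʳ f (y ∷ ys) x = cong (f y ∷_) (map-++ f ys (x ∷ []))

  ⁺∷ʳ-injective : ∀ {xs ys : List⁺ A} {x y : A} → xs ⁺∷ʳ x ≡ ys ⁺∷ʳ y → xs ≡ ys × x ≡ y
  ⁺∷ʳ-injective {x′ ∷ xs} {y′ ∷ ys} eq with ∷ʳ-injective (x′ ∷ xs) (y′ ∷ ys) (cong List⁺.toList eq)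
  ... | refl , x≡y = refl , x≡y

  [_]≢⁺∷ʳ : ∀ (x : A) {ys : List⁺ A} {y : A} → [ x ] ≢ ys ⁺∷ʳ y
  [ x ]≢⁺∷ʳ {_ ∷ []}    ()
  [ x ]≢⁺∷ʳ {_ ∷ _ ∷ _} ()

module Splicing {n : ℕ} (E : HomBroadcastEnv n) where
  open HomBroadcastEnv E

  bowJ : Fin (suc n) → JointAct → JointAct → JointAct
  bowJ i = spliceT {F = Act} i

  aJ-bowJ : ∀ i {j₁ j₂} → aJ j₁ ≡ aJ j₂ → aJ (bowJ i j₁ j₂) ≡ aJ j₁
  aJ-bowJ i {j₁} {j₂} a₁≡a₂ = begin
    aJ (bowJ i j₁ j₂)                  ≡⟨ mapT-spliceT {F = Act} {G = A} π π π i
                                            (λ _ → refl) (λ _ _ _ → refl) j₁ j₂ ⟩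
    spliceT {F = A} i (aJ j₁) (aJ j₂)  ≡⟨ cong (spliceT {F = A} i (aJ j₁)) (sym a₁≡a₂) ⟩
    spliceT {F = A} i (aJ j₁) (aJ j₁)  ≡⟨ updateT-lookupT {F = A} i (aJ j₁) ⟩
    aJ j₁                              ∎
    where
    open ≡-Reasoning
    π : (k : Fin (suc n)) → Act k → A k
    π _ = proj₁

  τJ-bowJ : ∀ i {j₁ j₂} (s t : State) → aJ j₁ ≡ aJ j₂ →
    τJ (bowJ i j₁ j₂) (bowS i s t) ≡ bowS i (τJ j₁ s) (τJ j₂ t)
  τJ-bowJ i {j₁} {j₂} s t a₁≡a₂ =
    cong₂ _,_ a≡a₁
      (mapT-spliceT {F = S} {G = S} (local j₁) (local j₂) (local j) i at-i off-i (proj₂ s) (proj₂ t))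
    where
    j = bowJ i j₁ j₂
    a≡a₁ = aJ-bowJ i a₁≡a₂
    local : JointAct → (k : Fin (suc n)) → S k → S k
    local 𝐣 k = τ k (aJ 𝐣) (proj₂ (lookupT {F = Act} 𝐣 k))
    at-i : ∀ p → local j i p ≡ local j₂ i p
    at-i p = cong₂ (λ a b → τ i a b p) (trans a≡a₁ a₁≡a₂)
                   (cong proj₂ (lookupT-updateT-≡ {F = Act} i (lookupT {F = Act} j₂ i) j₁))
    off-i : ∀ k → k ≢ i → ∀ p → local j k p ≡ local j₁ k p
    off-i k k≢i p = cong₂ (λ a b → τ k a b p) a≡a₁
                          (cong proj₂ (lookupT-updateT-≢ {F = Act} (lookupT {F = Act} j₂ i) j₁ k≢i))

  O-bowS-≡ : ∀ i (s t : State) → aS s ≡ aS t → O i (bowS i s t) ≡ O i t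
  O-bowS-≡ i s t a≡ = cong₂ _,_ a≡ (lookupT-updateT-≡ {F = S} i _ (proj₂ s))

  O-bowS-≢ : ∀ {i k} (s t : State) → k ≢ i → O k (bowS i s t) ≡ O k s
  O-bowS-≢ s t k≢i = cong (proj₁ s ,_) (lookupT-updateT-≢ {F = S} _ (proj₂ s) k≢i)

  Initial-bowS : ∀ i {s t} → Initial s → Initial t → Initial (bowS i s t)
  Initial-bowS i (a≡ε , Iₛ) (_ , Iₜ) = a≡ε , lookupT-updateT-elim {F = S} I (Iₜ i) (λ k _ → Iₛ k)

  data Pointwise (R : State → State → Set) : Run E → Run E → Set where
    ⟦_⟧ : ∀ {s t} → R s t → Pointwise R ⟦ s ⟧ ⟦ t ⟧
    _▷_ : ∀ {r r′ s t} → Pointwise R r r′ → R s t → Pointwise R (r ▷ s) (r′ ▷ t)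

  Pointwise-fin : ∀ {R r r′} → Pointwise R r r′ → R (fin E r) (fin E r′)
  Pointwise-fin ⟦ Rst ⟧   = Rst
  Pointwise-fin (_ ▷ Rst) = Rst

  map-states-▷ : ∀ {B : Set} (f : State → B) (r : Run E) (s : State) →
    List⁺.map f (states E (r ▷ s)) ≡ List⁺.map f (states E r) ⁺∷ʳ f s
  map-states-▷ f r = map-⁺∷ʳ f (states E r)

  map-states-≡⇒Pointwise : ∀ {B : Set} (f g : State → B) {r r′ : Run E} →
    List⁺.map f (states E r) ≡ List⁺.map g (states E r′) → Pointwise (λ s t → f s ≡ g t) r r′
  map-states-≡⇒Pointwise f g {⟦ s ⟧}  {⟦ t ⟧}   eq = ⟦ cong List⁺.head eq ⟧
  map-states-≡⇒Pointwise f g {⟦ s ⟧}  {r′ ▷ t}  eq = contradiction (trans eq (map-states-▷ g r′ t)) [ f s ]≢⁺∷ʳ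
  map-states-≡⇒Pointwise f g {r ▷ s}  {⟦ t ⟧}   eq = contradiction (trans (sym eq) (map-states-▷ f r s)) [ g t ]≢⁺∷ʳ
  map-states-≡⇒Pointwise f g {r ▷ s}  {r′ ▷ t}  eq
    with ⁺∷ʳ-injective (trans (sym (map-states-▷ f r s)) (trans eq (map-states-▷ g r′ t)))
  ... | prefix≡ , last≡ = map-states-≡⇒Pointwise f g prefix≡ ▷ last≡

  ∼⇒O-fin-≡ : ∀ {k r r′} → _∼[_]_ E r k r′ → O k (fin E r) ≡ O k (fin E r′)
  ∼⇒O-fin-≡ {k} {r} {r′} r∼r′ = Pointwise-fin (map-states-≡⇒Pointwise (O k) (O k) {r} {r′} r∼r′)

  ∼-▷ : ∀ {k r r′ s t} → _∼[_]_ E r k r′ → O k s ≡ O k t → _∼[_]_ E (r ▷ s) k (r′ ▷ t)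
  ∼-▷ {k} {r} {r′} {s} {t} r∼r′ Os≡Ot = begin
    obsSeq E k (r ▷ s)              ≡⟨ map-states-▷ (O k) r s ⟩
    obsSeq E k r ⁺∷ʳ O k s          ≡⟨ cong₂ _⁺∷ʳ_ r∼r′ Os≡Ot ⟩
    obsSeq E k r′ ⁺∷ʳ O k t         ≡⟨ sym (map-states-▷ (O k) r′ t) ⟩
    obsSeq E k (r′ ▷ t)             ∎
    where open ≡-Reasoning

  SameActions : Run E → Run E → Set
  SameActions = Pointwise (λ s t → aS s ≡ aS t)

  fin-bowR : ∀ i {r₁ r₂} → SameActions r₁ r₂ → fin E (bowR E i r₁ r₂) ≡ bowS i (fin E r₁) (fin E r₂)
  fin-bowR i ⟦ _ ⟧   = refl
  fin-bowR i (_ ▷ _) = refl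

  bowR-∼-≡ : ∀ i {r₁ r₂} → SameActions r₁ r₂ → _∼[_]_ E (bowR E i r₁ r₂) i r₂
  bowR-∼-≡ i (⟦_⟧ {s} {t} a≡) = cong [_] (O-bowS-≡ i s t a≡)
  bowR-∼-≡ i (_▷_ {r₁} {r₂} {s} {t} p a≡) =
    ∼-▷ {r = bowR E i r₁ r₂} {r₂} (bowR-∼-≡ i p) (O-bowS-≡ i s t a≡)

  bowR-∼-≢ : ∀ {i k r₁ r₂} → SameActions r₁ r₂ → k ≢ i → _∼[_]_ E (bowR E i r₁ r₂) k r₁
  bowR-∼-≢ (⟦_⟧ {s} {t} _) k≢i = cong [_] (O-bowS-≢ s t k≢i)
  bowR-∼-≢ {i} (_▷_ {r₁} {r₂} {s} {t} p _) k≢i =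
    ∼-▷ {r = bowR E i r₁ r₂} {r₁} (bowR-∼-≢ p k≢i) (O-bowS-≢ s t k≢i)

module Consistency {n : ℕ} (E : HomBroadcastEnv n) (𝐏 : JointProtocol E) where
  open HomBroadcastEnv E
  open JointProtocol 𝐏
  open Splicing E

  Allowed : Run E → (k : Fin (suc n)) → Act k → Set
  Allowed r zero    = P0 (fin E r)
  Allowed r (suc k) = P k (obsSeq E (suc k) r)

  Enabled⇒Allowed : ∀ {r j} → Enabled E 𝐏 r j → ∀ k → Allowed r k (lookupT {F = Act} j k)
  Enabled⇒Allowed (allowed₀ , _)        zero    = allowed₀
  Enabled⇒Allowed (_        , allowedₛ) (suc k) = allowedₛ k

  Allowed⇒Enabled : ∀ {r j} → (∀ k → Allowed r k (lookupT {F = Act} j k)) → Enabled E 𝐏 r j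
  Allowed⇒Enabled allowed = allowed zero , λ k → allowed (suc k)

  Allowed-resp-∼ : ∀ {k r r′ a} → _∼[_]_ E r k r′ → Allowed r k a → Allowed r′ k a
  Allowed-resp-∼ {zero}  {r} {r′} {a} r∼r′ = P0-local (fin E r) (fin E r′) (∼⇒O-fin-≡ {r = r} {r′} r∼r′) a
  Allowed-resp-∼ {suc k}      {a = a} r∼r′ = subst (λ o → P k o a) r∼r′

  Enabled-bowJ : ∀ i {r₁ r₂ r j₁ j₂} → Enabled E 𝐏 r₁ j₁ → Enabled E 𝐏 r₂ j₂ →
    _∼[_]_ E r₂ i r → (∀ k → k ≢ i → _∼[_]_ E r₁ k r) → Enabled E 𝐏 r (bowJ i j₁ j₂)
  Enabled-bowJ i {r₁} {r₂} {r} en₁ en₂ r₂∼r r₁∼r = Allowed⇒Enabled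
    (lookupT-updateT-elim {F = Act} (Allowed r)
      (Allowed-resp-∼ {r = r₂} r₂∼r (Enabled⇒Allowed en₂ i))
      (λ k k≢i → Allowed-resp-∼ {r = r₁} (r₁∼r k k≢i) (Enabled⇒Allowed en₁ k)))

  InF-bowR : ∀ i {r₁ r₂} → SameActions r₁ r₂ → InF E 𝐏 r₁ → InF E 𝐏 r₂ → InF E 𝐏 (bowR E i r₁ r₂)
  InF-bowR i ⟦ _ ⟧ (init _ init₁) (init _ init₂) = init _ (Initial-bowS i init₁ init₂)
  InF-bowR i (p ▷ a₁≡a₂) (step r₁ _ j₁ h₁ en₁ refl) (step r₂ _ j₂ h₂ en₂ refl) =
    step (bowR E i r₁ r₂) _ (bowJ i j₁ j₂) (InF-bowR i p h₁ h₂)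
      (Enabled-bowJ i {r₁} {r₂} {bowR E i r₁ r₂} en₁ en₂
        (sym (bowR-∼-≡ i p)) (λ k k≢i → sym (bowR-∼-≢ p k≢i)))
      (begin
        bowS i (τJ j₁ (fin E r₁)) (τJ j₂ (fin E r₂))     ≡⟨ τJ-bowJ i (fin E r₁) (fin E r₂) a₁≡a₂ ⟨
        τJ (bowJ i j₁ j₂) (bowS i (fin E r₁) (fin E r₂)) ≡⟨ cong (τJ (bowJ i j₁ j₂)) (fin-bowR i p) ⟨
        τJ (bowJ i j₁ j₂) (fin E (bowR E i r₁ r₂))     ∎)
    where open ≡-Reasoning

lemma6p2 : {n : ℕ} (E : HomBroadcastEnv n) (𝐏 : JointProtocol E)
           (r₁ r₂ : Run E) → InF E 𝐏 r₁ → InF E 𝐏 r₂ → ASeq E r₁ ≡ ASeq E r₂ →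
           (i : Fin (suc n)) →
           InF E 𝐏 (bowR E i r₁ r₂)
           × _∼[_]_ E (bowR E i r₁ r₂) i r₂
           × ((j : Fin (suc n)) → j ≢ i → _∼[_]_ E (bowR E i r₁ r₂) j r₁)
lemma6p2 E 𝐏 r₁ r₂ h₁ h₂ A₁≡A₂ i =
  InF-bowR i same h₁ h₂ , bowR-∼-≡ i same , λ j j≢i → bowR-∼-≢ same j≢i
  where
  open HomBroadcastEnv E using (aS)
  open Splicing E
  open Consistency E 𝐏
  same : SameActions r₁ r₂
  same = map-states-≡⇒Pointwise aS aS A₁≡A₂
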